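{- Let $\mathcal{P}=(P,\leq)$ be a finite bounded poset with $n$ elements, $c$ covering relations and $k$ atoms, and let $m>0$. Then $\ell(\mathcal{P}^{\langle m\rangle})=m\cdot\ell(\mathcal{P})$ and $$\bigl\lvert \mathcal{P}^{\langle m\rangle}\bigr\rvert=(c-k)\binom{m}{2}+m(n-1)+1.$$
   Context: For a finite bounded poset $\mathcal{P}$ with least element $\hat0$ and $m>0$, the $m$-cover poset $\mathcal{P}^{\langle m\rangle}$ is the subposet of the componentwise-ordered direct product $\mathcal{P}^m$ consisting of the multichains $x_1\le\cdots\le x_m$ of $\mathcal P$ such that $\{x_1,\dots,x_m\}\setminus\{\hat0\}$ is empty, a single element, or a two-element set $\{p,q\}$ with $p\lessdot q$ (a covering relation). An atom is an element covering $\hat 0$. The length $\ell(\cdot)$ of a bounded poset is the maximal number of covering steps in a saturated chain from its least to its greatest element. -}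

module Defs where

open import Data.Nat using (ℕ; zero; suc)
open import Data.Fin using (Fin; toℕ)
open import Data.Nat as ℕ using ()
open import Data.Vec using (Vec; lookup)
open import Data.List using (List; length)
open import Data.List.Membership.Propositional using (_∈_)
open import Data.List.Relation.Unary.All using (All)
open import Data.List.Relation.Unary.Unique.Propositional using (Unique)
open import Data.Product using (Σ; ∃; _×_; _,_; proj₁; proj₂)
open import Data.Sum using (_⊎_)
open import Relation.Nullary using (¬_)
open import Relation.Binary.PropositionalEquality using (_≡_; _≢_)
open import Relation.Binary.Structures using (IsPartialOrder)

module _ {A : Set} (_≤_ : A → A → Set) where

  Lt : A → A → Set
  Lt x y = (x ≤ y) × ¬ (y ≤ x)

  Covers : A → A → Set
  Covers x y = Lt x y × (∀ z → ¬ (Lt x z × Lt z y))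

  IsLeast : A → Set
  IsLeast b = ∀ y → b ≤ y

  IsGreatest : A → Set
  IsGreatest t = ∀ y → y ≤ t

  data SatChain : A → A → ℕ → Set where
    done : ∀ {a b} → a ≤ b → b ≤ a → SatChain a b 0
    step : ∀ {a c b L} → Covers a c → SatChain c b L → SatChain a b (suc L)

  IsLength : ℕ → Set
  IsLength L =
    Σ A λ b → Σ A λ t → IsLeast b × IsGreatest t ×
      SatChain b t L × (∀ L' → SatChain b t L' → L' ℕ.≤ L)

CountIs : {A : Set} → (A → Set) → ℕ → Set
CountIs {A} P N =
  Σ (List A) λ xs → (length xs ≡ N) × Unique xs × All P xs × (∀ x → P x → x ∈ xs)

record FiniteBoundedPoset (n : ℕ) : Set₁ where
  field
    _≤_       : Fin n → Fin n → Set
    isPartialOrder : IsPartialOrder _≡_ _≤_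
    ⊥̂         : Fin n
    ⊤̂         : Fin n
    ⊥̂-least   : ∀ x → ⊥̂ ≤ x
    ⊤̂-greatest : ∀ x → x ≤ ⊤̂

  _⋖_ : Fin n → Fin n → Set
  _⋖_ = Covers _≤_

  IsAtom : Fin n → Set
  IsAtom a = ⊥̂ ⋖ a

  IsCoverPair : Fin n × Fin n → Set
  IsCoverPair pq = proj₁ pq ⋖ proj₂ pq

  IsMultichain : ∀ {m} → Vec (Fin n) m → Set
  IsMultichain {m} x = ∀ (i j : Fin m) → toℕ i ℕ.≤ toℕ j → lookup x i ≤ lookup x j

  -- {x₁,…,x_m} ∖ {⊥̂} is empty, a singleton, or {p,q} with p ⋖ q
  NonBotSetOK : ∀ {m} → Vec (Fin n) m → Set
  NonBotSetOK {m} x =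
      (∀ i → lookup x i ≡ ⊥̂)
    ⊎ (Σ (Fin n) λ p → p ≢ ⊥̂ × (∀ i → lookup x i ≡ ⊥̂ ⊎ lookup x i ≡ p)
                     × (∃ λ i → lookup x i ≡ p))
    ⊎ (Σ (Fin n) λ p → Σ (Fin n) λ q → p ≢ ⊥̂ × q ≢ ⊥̂ × p ⋖ q
                     × (∀ i → lookup x i ≡ ⊥̂ ⊎ lookup x i ≡ p ⊎ lookup x i ≡ q)
                     × (∃ λ i → lookup x i ≡ p) × (∃ λ j → lookup x j ≡ q))

  IsCoverPosetElt : ∀ {m} → Vec (Fin n) m → Set
  IsCoverPosetElt x = IsMultichain x × NonBotSetOK x

  CoverPoset : ℕ → Set
  CoverPoset m = Σ (Vec (Fin n) m) IsCoverPosetElt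

  CoverOrder : (m : ℕ) → CoverPoset m → CoverPoset m → Set
  CoverOrder m x y = ∀ (i : Fin m) → lookup (proj₁ x) i ≤ lookup (proj₁ y) i

-- Every element of P^⟨m⟩ is a staircase: the all-⊥̂ multichain, ⊥̂^a p^(m−a) with p ≠ ⊥̂ and a < m, or
-- ⊥̂^a p^(e−a) q^(m−e) with p ⋖ q, p ≠ ⊥̂ and a < e < m; a and e are read off as the places where the
-- entries stop being ⊥̂ and start being q. Counting the parameters gives the formula, the covers (⊥̂, q)
-- being exactly the atoms.
-- A cover p ⋖ q lifts to m covers from p^m to q^m, turning one p into q at a time, so a longest saturated
-- chain of P lifts to one of length m·ℓ(P) between constant multichains. Conversely every cover in P^⟨m⟩
-- moves some coordinate, so projecting a saturated chain to the coordinates and refining each move to a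
-- saturated chain of P bounds its length by m·ℓ(P).

module Submission where

open import Defs
open import Data.Nat using (ℕ; zero; suc; _+_; _*_; _∸_; _≤_; _<_; z≤n; s≤s; _<?_; _≤?_)
open import Data.Nat.Properties
open import Data.Nat.Combinatorics using (_C_; nC1≡n; nCk+nC[k+1]≡[n+1]C[k+1])
open import Data.Nat.Induction using (<-wellFounded)
open import Data.Nat.Tactic.RingSolver using (solve-∀)
open import Data.Fin using (Fin; toℕ; fromℕ<) renaming (zero to fzero; suc to fsuc)
import Data.Fin.Properties as Fin
open import Data.List using (List; []; _∷_; length; map; filter; _++_; cartesianProduct; upTo; allFin)
open import Data.List.Properties using (length-++; length-map; length-upTo; length-tabulate)
open import Data.List.Membership.Propositional.Properties
  using ( ∈-++⁺ˡ; ∈-++⁺ʳ; ∈-map⁺; ∈-filter⁺; ∈-filter⁻; ∈-cartesianProduct⁺; ∈-cartesianProduct⁻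
        ; ∈-upTo⁺; ∈-upTo⁻; ∈-allFin)
open import Data.List.Membership.Propositional.Properties.WithK using (unique∧set⇒bag)
open import Data.List.Relation.Binary.BagAndSetEquality using (∼bag⇒↭)
open import Data.List.Relation.Binary.Permutation.Propositional.Properties using (↭-length)
open import Data.List.Relation.Unary.Any using (here)
open import Data.List.Relation.Unary.All as All using (All; []; _∷_)
import Data.List.Relation.Unary.All.Properties as All
open import Data.List.Relation.Unary.AllPairs using ([]; _∷_)
open import Data.List.Relation.Unary.Unique.Propositional using (Unique)
import Data.List.Relation.Unary.Unique.Propositional.Properties as Unique
open import Data.Vec using (Vec; lookup; tabulate; replicate)
open import Data.Vec.Properties using (lookup∘tabulate; lookup-replicate)
open import Data.Vec.Relation.Binary.Pointwise.Extensional using (ext; Pointwise-≡⇒≡)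
open import Data.Product using (Σ; ∃; _×_; _,_; proj₁; proj₂)
import Data.Sum as Sum
open import Data.Sum using (_⊎_; inj₁; inj₂; [_,_]; map₂)
open import Data.Unit using (⊤; tt)
open import Data.Empty using (⊥-elim)
open import Function using (_∘_; id; mk⇔)
open import Induction.WellFounded using (Acc; acc)
open import Relation.Nullary using (¬_; Dec; yes; no; ¬?; _×-dec_)
open import Relation.Nullary.Decidable using (decidable-stable; ¬¬-excluded-middle)
open import Relation.Unary using (Decidable)
open import Relation.Binary.Definitions using (Transitive; DecidableEquality; tri<; tri≈; tri>)
  renaming (Decidable to Decidable₂)
open import Relation.Binary.Structures using (IsPreorder; IsPartialOrder)
open import Relation.Binary.PropositionalEquality
  using (_≡_; _≢_; ≢-sym; refl; sym; trans; cong; cong₂; subst; subst₂; module ≡-Reasoning)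
open import Algebra.Properties.Monoid.Sum +-0-monoid using (sum)

-- Counting

length-cartesianProduct : ∀ {A B : Set} (xs : List A) (ys : List B) →
  length (cartesianProduct xs ys) ≡ length xs * length ys
length-cartesianProduct []       ys = refl
length-cartesianProduct (x ∷ xs) ys = trans (length-++ (map (x ,_) ys))
  (cong₂ _+_ (length-map (x ,_) ys) (length-cartesianProduct xs ys))

module _ {A : Set} {P Q : A → Set} where

  CountIs-cong : (∀ {x} → P x → Q x) → (∀ {x} → Q x → P x) →
    ∀ {k} → CountIs P k → CountIs Q k
  CountIs-cong P⇒Q Q⇒P (xs , len , uniq , all , complete) =
    xs , len , uniq , All.map P⇒Q all , λ x → complete x ∘ Q⇒P

  CountIs-⊎ : (∀ {x} → P x → ¬ Q x) → ∀ {k l} → CountIs P k → CountIs Q l →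
    CountIs (λ x → P x ⊎ Q x) (k + l)
  CountIs-⊎ disjoint (xs , refl , uxs , Pxs , cxs) (ys , refl , uys , Qys , cys) =
    xs ++ ys , length-++ xs ,
    Unique.++⁺ uxs uys (λ (x∈ , y∈) → disjoint (All.lookup Pxs x∈) (All.lookup Qys y∈)) ,
    All.++⁺ (All.map inj₁ Pxs) (All.map inj₂ Qys) ,
    λ { x (inj₁ px) → ∈-++⁺ˡ (cxs x px) ; x (inj₂ qx) → ∈-++⁺ʳ xs (cys x qx) }

  CountIs-filter : Decidable Q → ∀ {k} → CountIs P k →
    ∃ λ l → CountIs (λ x → P x × Q x) l
  CountIs-filter Q? (xs , _ , uxs , Pxs , cxs) =
    _ , filter Q? xs , refl , Unique.filter⁺ Q? uxs ,
    All.tabulate (λ x∈ → let x∈xs , qx = ∈-filter⁻ Q? x∈ in All.lookup Pxs x∈xs , qx) ,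
    λ x (px , qx) → ∈-filter⁺ Q? (cxs x px) qx

CountIs-nonempty : ∀ {A : Set} {P : A → Set} {k x} → CountIs P k → P x → 1 ≤ k
CountIs-nonempty (_ ∷ _ , refl , _) _ = s≤s z≤n
CountIs-nonempty ([] , refl , _ , _ , cxs) px with () ← cxs _ px

module _ {A : Set} {P : A → Set} where

  CountIs-unique : ∀ {k l} → CountIs P k → CountIs P l → k ≡ l
  CountIs-unique (xs , refl , uxs , Pxs , cxs) (ys , refl , uys , Pys , cys) =
    ↭-length (∼bag⇒↭ (unique∧set⇒bag uxs uys
      (mk⇔ (λ x∈ → cys _ (All.lookup Pxs x∈)) (λ y∈ → cxs _ (All.lookup Pys y∈)))))

  module _ {Q : A → Set} (Q? : Decidable Q) where

    CountIs-split : ∀ {k l r} → CountIs (λ x → P x × Q x) l → CountIs (λ x → P x × ¬ Q x) r →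
      CountIs P k → k ≡ l + r
    CountIs-split cQ c¬Q cP =
      CountIs-unique cP (CountIs-cong forget split (CountIs-⊎ (λ (_ , q) (_ , ¬q) → ¬q q) cQ c¬Q))
      where
      forget : ∀ {x} → (P x × Q x) ⊎ (P x × ¬ Q x) → P x
      forget (inj₁ (px , _)) = px
      forget (inj₂ (px , _)) = px
      split : ∀ {x} → P x → (P x × Q x) ⊎ (P x × ¬ Q x)
      split {x} px with Q? x
      ... | yes qx = inj₁ (px , qx)
      ... | no ¬qx = inj₂ (px , ¬qx)

    CountIs-∖ : ∀ {k l} → CountIs P k → CountIs (λ x → P x × Q x) l →
      CountIs (λ x → P x × ¬ Q x) (k ∸ l)
    CountIs-∖ {l = l} cP cQ with CountIs-filter (¬? ∘ Q?) cP
    ... | r , c¬Q rewrite CountIs-split cQ c¬Q cP | m+n∸m≡n l r = c¬Q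

    CountIs-mono-< : ∀ {k l w} → (∀ {x} → Q x → P x) → CountIs Q k → CountIs P l →
      P w → ¬ Q w → k < l
    CountIs-mono-< {k} Q⇒P cQ cP pw ¬qw with CountIs-filter (¬? ∘ Q?) cP
    ... | r , c¬Q = subst (k <_) (sym (CountIs-split (CountIs-cong (λ q → Q⇒P q , q) proj₂ cQ) c¬Q cP))
      (m<m+n k (CountIs-nonempty c¬Q (pw , ¬qw)))

CountIs-image : ∀ {A B : Set} {P : A → Set} (f : A → B) →
  (∀ {x y} → P x → P y → f x ≡ f y → x ≡ y) →
  ∀ {k} → CountIs P k → CountIs (λ y → ∃ λ x → P x × f x ≡ y) k
CountIs-image {P = P} f injective (xs , refl , uxs , Pxs , cxs) =
  map f xs , length-map f xs , unique-map Pxs uxs ,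
  All.map⁺ (All.map (λ px → _ , px , refl) Pxs) ,
  λ { _ (x , px , refl) → ∈-map⁺ f (cxs x px) }
  where
  unique-map : ∀ {xs} → All P xs → Unique xs → Unique (map f xs)
  unique-map []         []           = []
  unique-map (px ∷ Pxs) (x∉ ∷ uxs) =
    All.map⁺ (All.zipWith (λ (x≢y , py) fx≡fy → x≢y (injective px py fx≡fy)) (x∉ , Pxs))
    ∷ unique-map Pxs uxs

CountIs-× : ∀ {A B : Set} {P : A → Set} {Q : B → Set} {k l} → CountIs P k → CountIs Q l →
  CountIs (λ xy → P (proj₁ xy) × Q (proj₂ xy)) (k * l)
CountIs-× (xs , refl , uxs , Pxs , cxs) (ys , refl , uys , Qys , cys) =
  cartesianProduct xs ys , length-cartesianProduct xs ys , Unique.cartesianProduct⁺ uxs uys ,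
  All.tabulate (λ xy∈ → let x∈ , y∈ = ∈-cartesianProduct⁻ xs ys xy∈ in
    All.lookup Pxs x∈ , All.lookup Qys y∈) ,
  λ (x , y) (px , qy) → ∈-cartesianProduct⁺ (cxs x px) (cys y qy)

CountIs-≡ : ∀ {A : Set} (a : A) → CountIs (_≡ a) 1
CountIs-≡ a = a ∷ [] , refl , [] ∷ [] , refl ∷ [] , λ { _ refl → here refl }

CountIs-Fin : ∀ n → CountIs {Fin n} (λ _ → ⊤) n
CountIs-Fin n = allFin n , length-tabulate _ , Unique.allFin⁺ n , All.tabulate _ , λ i _ → ∈-allFin i

CountIs-< : ∀ m → CountIs (_< m) m
CountIs-< m = upTo m , length-upTo m , Unique.upTo⁺ m , All.tabulate ∈-upTo⁻ , λ _ → ∈-upTo⁺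

CountIs-pairs< : ∀ m → CountIs (λ ae → proj₁ ae < proj₂ ae × proj₂ ae < m) (m C 2)
CountIs-pairs< zero = [] , refl , [] , [] , λ { _ (_ , ()) }
CountIs-pairs< (suc m) = subst (CountIs _) pascal
  (CountIs-cong join split
    (CountIs-⊎ (λ { (_ , e<m) (_ , _ , refl) → <-irrefl refl e<m })
      (CountIs-pairs< m) (CountIs-image (_, m) (λ _ _ → cong proj₁) (CountIs-< m))))
  where
  pascal : m C 2 + m ≡ suc m C 2
  pascal = trans (+-comm (m C 2) m)
    (trans (cong (_+ m C 2) (sym (nC1≡n m))) (nCk+nC[k+1]≡[n+1]C[k+1] m 1))
  join : ∀ {ae} → (proj₁ ae < proj₂ ae × proj₂ ae < m) ⊎ (∃ λ a → a < m × (a , m) ≡ ae) →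
    proj₁ ae < proj₂ ae × proj₂ ae < suc m
  join (inj₁ (a<e , e<m)) = a<e , m<n⇒m<1+n e<m
  join (inj₂ (_ , a<m , refl)) = a<m , ≤-refl
  split : ∀ {ae} → proj₁ ae < proj₂ ae × proj₂ ae < suc m →
    (proj₁ ae < proj₂ ae × proj₂ ae < m) ⊎ (∃ λ a → a < m × (a , m) ≡ ae)
  split {a , e} (a<e , e<1+m) with m<1+n⇒m<n∨m≡n e<1+m
  ... | inj₁ e<m = inj₁ (a<e , e<m)
  ... | inj₂ refl = inj₂ (a , a<e , refl)

CountIs-Fin-decidable : ∀ {k} {Q : Fin k → Set} → Decidable Q → ∃ λ l → CountIs Q l
CountIs-Fin-decidable {k} Q? =
  let l , count = CountIs-filter Q? (CountIs-Fin k) in l , CountIs-cong proj₂ (tt ,_) count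

-- Sums and thresholds over Fin

sum-mono-≤ : ∀ {m} {f g : Fin m → ℕ} → (∀ i → f i ≤ g i) → sum f ≤ sum g
sum-mono-≤ {zero}  f≤g = z≤n
sum-mono-≤ {suc m} f≤g = +-mono-≤ (f≤g fzero) (sum-mono-≤ (f≤g ∘ fsuc))

sum-+ : ∀ {m} (f g : Fin m → ℕ) → sum (λ i → f i + g i) ≡ sum f + sum g
sum-+ {zero}  f g = refl
sum-+ {suc m} f g rewrite sum-+ (λ i → f (fsuc i)) (λ i → g (fsuc i)) =
  +-+-comm (f fzero) (g fzero) _ _
  where
  +-+-comm : ∀ a b c d → (a + b) + (c + d) ≡ (a + c) + (b + d)
  +-+-comm = solve-∀

sum-const : ∀ m L → sum {m} (λ _ → L) ≡ m * L
sum-const zero    L = refl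
sum-const (suc m) L = cong (L +_) (sum-const m L)

term≤sum : ∀ {m} (f : Fin m → ℕ) i → f i ≤ sum f
term≤sum f fzero    = m≤m+n _ _
term≤sum f (fsuc i) = ≤-trans (term≤sum (λ j → f (fsuc j)) i) (m≤n+m _ (f fzero))

∀¬¬⇒¬¬∀ : ∀ {m} {Q : Fin m → Set} → (∀ i → ¬ ¬ Q i) → ¬ ¬ (∀ i → Q i)
∀¬¬⇒¬¬∀ {zero}      _     ¬∀ = ¬∀ λ ()
∀¬¬⇒¬¬∀ {suc m} {Q} ¬¬Q ¬∀ = ¬¬Q fzero λ q₀ →
  ∀¬¬⇒¬¬∀ {Q = Q ∘ fsuc} (¬¬Q ∘ fsuc) λ qs → ¬∀ λ { fzero → q₀ ; (fsuc i) → qs i }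

UpwardClosed : ∀ {m} → (Fin m → Set) → Set
UpwardClosed Q = ∀ {i j} → toℕ i ≤ toℕ j → Q i → Q j

upwardClosed⇒threshold : ∀ {m} {Q : Fin m → Set} → Decidable Q → UpwardClosed Q →
  Σ ℕ λ t → t ≤ m × (∀ i → toℕ i < t → ¬ Q i) × (∀ i → t ≤ toℕ i → Q i)
upwardClosed⇒threshold {zero} Q? up = 0 , z≤n , (λ ()) , (λ ())
upwardClosed⇒threshold {suc m} {Q} Q? up with Q? fzero
... | yes q₀ = 0 , z≤n , (λ _ ()) , (λ i _ → up z≤n q₀)
... | no ¬q₀ with upwardClosed⇒threshold (λ i → Q? (fsuc i)) (λ i≤j → up (s≤s i≤j))
...   | t , t≤m , below , above = suc t , s≤s t≤m , below′ , above′
  where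
  below′ : ∀ i → toℕ i < suc t → ¬ Q i
  below′ fzero    _         = ¬q₀
  below′ (fsuc i) (s≤s i<t) = below i i<t
  above′ : ∀ i → suc t ≤ toℕ i → Q i
  above′ (fsuc i) (s≤s t≤i) = above i t≤i

threshold-unique : ∀ {m t t′} → t ≤ m → t′ ≤ m →
  (∀ (i : Fin m) → toℕ i < t → toℕ i < t′) → (∀ (i : Fin m) → toℕ i < t′ → toℕ i < t) → t ≡ t′
threshold-unique t≤m t′≤m t⇒t′ t′⇒t = ≤-antisym (bounded t≤m t⇒t′) (bounded t′≤m t′⇒t)
  where
  bounded : ∀ {m t t′} → t ≤ m → (∀ (i : Fin m) → toℕ i < t → toℕ i < t′) → t ≤ t′
  bounded {t′ = t′} t≤m below = ≮⇒≥ λ t′<t →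
    let i = fromℕ< (<-≤-trans t′<t t≤m) ; toℕi≡t′ = Fin.toℕ-fromℕ< (<-≤-trans t′<t t≤m) in
    <-irrefl refl (subst (_< t′) toℕi≡t′ (below i (subst (_< _) (sym toℕi≡t′) t′<t)))

-- Staircase vectors

lookup-≡ : ∀ {A : Set} {m} {v w : Vec A m} → v ≡ w → ∀ i → lookup v i ≡ lookup w i
lookup-≡ v≡w i = cong (λ v → lookup v i) v≡w

module _ {A : Set} {m : ℕ} where

  private
    pick : {P : Set} → Dec P → A → A → A
    pick (yes _) x _ = x
    pick (no _)  _ y = y

  -- Opaque, so that the arguments of a staircase can be inferred from its lookups.
  opaque
    staircase : A → A → A → ℕ → ℕ → Vec A m
    staircase x y z a e = tabulate λ i → pick (toℕ i <? a) x (pick (toℕ i <? e) y z)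

    lookup-staircase : ∀ {x y z a e} i →
      lookup (staircase x y z a e) i ≡ pick (toℕ i <? a) x (pick (toℕ i <? e) y z)
    lookup-staircase i = lookup∘tabulate _ i

  module _ {x y z : A} {a e : ℕ} (i : Fin m) where

    lookup-staircase-< : toℕ i < a → lookup (staircase x y z a e) i ≡ x
    lookup-staircase-< i<a rewrite lookup-staircase {x} {y} {z} {a} {e} i with toℕ i <? a
    ... | yes _  = refl
    ... | no i≮a = ⊥-elim (i≮a i<a)

    lookup-staircase-mid : a ≤ toℕ i → toℕ i < e → lookup (staircase x y z a e) i ≡ y
    lookup-staircase-mid a≤i i<e rewrite lookup-staircase {x} {y} {z} {a} {e} i with toℕ i <? a | toℕ i <? e
    ... | yes i<a | _      = ⊥-elim (≤⇒≯ a≤i i<a)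
    ... | no _    | yes _  = refl
    ... | no _    | no i≮e = ⊥-elim (i≮e i<e)

    lookup-staircase-≥ : a ≤ toℕ i → e ≤ toℕ i → lookup (staircase x y z a e) i ≡ z
    lookup-staircase-≥ a≤i e≤i rewrite lookup-staircase {x} {y} {z} {a} {e} i with toℕ i <? a | toℕ i <? e
    ... | yes i<a | _      = ⊥-elim (≤⇒≯ a≤i i<a)
    ... | no _    | yes i<e = ⊥-elim (≤⇒≯ e≤i i<e)
    ... | no _    | no _   = refl

    staircase-values : lookup (staircase x y z a e) i ≡ x ⊎ lookup (staircase x y z a e) i ≡ y
                                                        ⊎ lookup (staircase x y z a e) i ≡ z
    staircase-values with toℕ i <? a | toℕ i <? e
    ... | yes i<a | _      = inj₁ (lookup-staircase-< i<a)
    ... | no i≮a  | yes i<e = inj₂ (inj₁ (lookup-staircase-mid (≮⇒≥ i≮a) i<e))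
    ... | no i≮a  | no i≮e  = inj₂ (inj₂ (lookup-staircase-≥ (≮⇒≥ i≮a) (≮⇒≥ i≮e)))

  module _ (_R_ : A → A → Set) (R-refl : ∀ {u} → u R u)
           {x y z : A} (xRy : x R y) (yRz : y R z) (xRz : x R z) {a e : ℕ} where

    private
      via : ∀ {i j u v} → lookup (staircase x y z a e) i ≡ u → lookup (staircase x y z a e) j ≡ v →
        u R v → lookup (staircase x y z a e) i R lookup (staircase x y z a e) j
      via refl refl r = r

      low : ∀ i → toℕ i < a → lookup (staircase x y z a e) i ≡ x
      low = lookup-staircase-<
      mid : ∀ i → ¬ toℕ i < a → toℕ i < e → lookup (staircase x y z a e) i ≡ y
      mid i i≮a = lookup-staircase-mid i (≮⇒≥ i≮a)
      high : ∀ i → ¬ toℕ i < a → ¬ toℕ i < e → lookup (staircase x y z a e) i ≡ z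
      high i i≮a i≮e = lookup-staircase-≥ i (≮⇒≥ i≮a) (≮⇒≥ i≮e)

    staircase-monotone : ∀ {i j} → toℕ i ≤ toℕ j →
      lookup (staircase x y z a e) i R lookup (staircase x y z a e) j
    staircase-monotone {i} {j} i≤j with toℕ j <? a | toℕ j <? e | toℕ i <? a | toℕ i <? e
    ... | yes j<a | _       | _       | _       = via (low i (≤-<-trans i≤j j<a)) (low j j<a) R-refl
    ... | no j≮a  | yes j<e | yes i<a | _       = via (low i i<a) (mid j j≮a j<e) xRy
    ... | no j≮a  | yes j<e | no i≮a  | _       = via (mid i i≮a (≤-<-trans i≤j j<e)) (mid j j≮a j<e) R-refl
    ... | no j≮a  | no j≮e  | yes i<a | _       = via (low i i<a) (high j j≮a j≮e) xRz
    ... | no j≮a  | no j≮e  | no i≮a  | yes i<e = via (mid i i≮a i<e) (high j j≮a j≮e) yRz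
    ... | no j≮a  | no j≮e  | no i≮a  | no i≮e  = via (high i i≮a i≮e) (high j j≮a j≮e) R-refl

  module _ {x y z : A} {a e : ℕ} {i : Fin m} where

    staircase-x⇒< : y ≢ x → z ≢ x → lookup (staircase x y z a e) i ≡ x → toℕ i < a
    staircase-x⇒< y≢x z≢x v≡x with toℕ i <? a | toℕ i <? e
    ... | yes i<a | _       = i<a
    ... | no i≮a  | yes i<e = ⊥-elim (y≢x (trans (sym (lookup-staircase-mid i (≮⇒≥ i≮a) i<e)) v≡x))
    ... | no i≮a  | no i≮e  = ⊥-elim (z≢x (trans (sym (lookup-staircase-≥ i (≮⇒≥ i≮a) (≮⇒≥ i≮e))) v≡x))

    staircase-<⇒xy : toℕ i < e → lookup (staircase x y z a e) i ≡ x ⊎ lookup (staircase x y z a e) i ≡ y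
    staircase-<⇒xy i<e with toℕ i <? a
    ... | yes i<a = inj₁ (lookup-staircase-< i i<a)
    ... | no i≮a  = inj₂ (lookup-staircase-mid i (≮⇒≥ i≮a) i<e)

    staircase-xy⇒< : z ≢ x → z ≢ y → a ≤ e →
      lookup (staircase x y z a e) i ≡ x ⊎ lookup (staircase x y z a e) i ≡ y → toℕ i < e
    staircase-xy⇒< z≢x z≢y a≤e v≡xy with toℕ i <? e
    ... | yes i<e = i<e
    ... | no i≮e  = ⊥-elim ([ z≢x , z≢y ] (Sum.map (trans (sym v≡z)) (trans (sym v≡z)) v≡xy))
      where
      v≡z : lookup (staircase x y z a e) i ≡ z
      v≡z = lookup-staircase-≥ i (≤-trans a≤e (≮⇒≥ i≮e)) (≮⇒≥ i≮e)

  module _ {x y z y′ z′ : A} {a e a′ e′ : ℕ} where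

    staircase-x-threshold : y ≢ x → z ≢ x → y′ ≢ x → z′ ≢ x → a ≤ m → a′ ≤ m →
      staircase x y z a e ≡ staircase x y′ z′ a′ e′ → a ≡ a′
    staircase-x-threshold y≢x z≢x y′≢x z′≢x a≤m a′≤m eq = threshold-unique a≤m a′≤m
      (λ i i<a → staircase-x⇒< y′≢x z′≢x (trans (lookup-≡ (sym eq) i) (lookup-staircase-< i i<a)))
      (λ i i<a′ → staircase-x⇒< y≢x z≢x (trans (lookup-≡ eq i) (lookup-staircase-< i i<a′)))

  module _ {x y z z′ : A} {a e a′ e′ : ℕ} where

    staircase-xy-threshold : z ≢ x → z ≢ y → z′ ≢ x → z′ ≢ y → a ≤ e → a′ ≤ e′ → e ≤ m → e′ ≤ m →
      staircase x y z a e ≡ staircase x y z′ a′ e′ → e ≡ e′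
    staircase-xy-threshold z≢x z≢y z′≢x z′≢y a≤e a′≤e′ e≤m e′≤m eq = threshold-unique e≤m e′≤m
      (λ i i<e → staircase-xy⇒< z′≢x z′≢y a′≤e′ (transport eq i (staircase-<⇒xy i<e)))
      (λ i i<e′ → staircase-xy⇒< z≢x z≢y a≤e (transport (sym eq) i (staircase-<⇒xy i<e′)))
      where
      transport : ∀ {v w : Vec A m} → v ≡ w →
        ∀ i → lookup v i ≡ x ⊎ lookup v i ≡ y → lookup w i ≡ x ⊎ lookup w i ≡ y
      transport v≡w i = Sum.map (trans (lookup-≡ (sym v≡w) i)) (trans (lookup-≡ (sym v≡w) i))

  staircase-ext : ∀ {v : Vec A m} {x y z a e} →
    (∀ i → toℕ i < a → lookup v i ≡ x) → (∀ i → a ≤ toℕ i → toℕ i < e → lookup v i ≡ y) →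
    (∀ i → a ≤ toℕ i → e ≤ toℕ i → lookup v i ≡ z) → v ≡ staircase x y z a e
  staircase-ext {v} {a = a} {e} below middle above = Pointwise-≡⇒≡ (ext λ i → pointwise i)
    where
    pointwise : ∀ i → lookup v i ≡ lookup (staircase _ _ _ a e) i
    pointwise i with toℕ i <? a | toℕ i <? e
    ... | yes i<a | _       = trans (below i i<a) (sym (lookup-staircase-< i i<a))
    ... | no i≮a  | yes i<e = let a≤i = ≮⇒≥ i≮a in
      trans (middle i a≤i i<e) (sym (lookup-staircase-mid i a≤i i<e))
    ... | no i≮a  | no i≮e  = let a≤i = ≮⇒≥ i≮a ; e≤i = ≮⇒≥ i≮e in
      trans (above i a≤i e≤i) (sym (lookup-staircase-≥ i a≤i e≤i))

  module _ {x y z : A} {a e k : ℕ} (k<m : k < m) where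

    lookup-staircase-mid-at : a ≤ k → k < e → lookup (staircase x y z a e) (fromℕ< k<m) ≡ y
    lookup-staircase-mid-at a≤k k<e =
      lookup-staircase-mid _ (subst (a ≤_) (sym k≡) a≤k) (subst (_< e) (sym k≡) k<e)
      where k≡ = Fin.toℕ-fromℕ< k<m

    lookup-staircase-≥-at : a ≤ k → e ≤ k → lookup (staircase x y z a e) (fromℕ< k<m) ≡ z
    lookup-staircase-≥-at a≤k e≤k =
      lookup-staircase-≥ _ (subst (a ≤_) (sym k≡) a≤k) (subst (e ≤_) (sym k≡) e≤k)
      where k≡ = Fin.toℕ-fromℕ< k<m

-- Saturated chains

module SatChainProperties {A : Set} {_≤_ : A → A → Set} (≤-trans : Transitive _≤_) where

  Covers-respˡ : ∀ {a a′ c} → a′ ≤ a → a ≤ a′ → Covers _≤_ a c → Covers _≤_ a′ c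
  Covers-respˡ a′≤a a≤a′ ((a≤c , c≰a) , nothing-between) =
    (≤-trans a′≤a a≤c , λ c≤a′ → c≰a (≤-trans c≤a′ a′≤a)) ,
    λ z ((a′≤z , z≰a′) , z<c) →
      nothing-between z ((≤-trans a≤a′ a′≤z , λ z≤a → z≰a′ (≤-trans z≤a a≤a′)) , z<c)

  SatChain-respˡ : ∀ {a a′ b L} → a′ ≤ a → a ≤ a′ → SatChain _≤_ a b L → SatChain _≤_ a′ b L
  SatChain-respˡ a′≤a a≤a′ (done a≤b b≤a) = done (≤-trans a′≤a a≤b) (≤-trans b≤a a≤a′)
  SatChain-respˡ a′≤a a≤a′ (step a⋖c rest) = step (Covers-respˡ a′≤a a≤a′ a⋖c) rest

  SatChain-++ : ∀ {a b c L L′} → SatChain _≤_ a b L → SatChain _≤_ b c L′ → SatChain _≤_ a c (L + L′)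
  SatChain-++ (done a≤b b≤a) rest = SatChain-respˡ a≤b b≤a rest
  SatChain-++ (step a⋖d rest) rest′ = step a⋖d (SatChain-++ rest rest′)

module _ {k} {_⊑_ : Fin k → Fin k → Set} (isPartialOrder : IsPartialOrder _≡_ _⊑_)
         (_⊑?_ : Decidable₂ _⊑_) where

  private
    module ⊑ = IsPartialOrder isPartialOrder
    _<ₚ_ = Lt _⊑_

    Between : Fin k → Fin k → Fin k → Set
    Between a b z = a <ₚ z × z <ₚ b

    Between? : ∀ a b → Decidable (Between a b)
    Between? a b z = ((a ⊑? z) ×-dec ¬? (z ⊑? a)) ×-dec ((z ⊑? b) ×-dec ¬? (b ⊑? z))

    #Between : Fin k → Fin k → ℕ
    #Between a b = proj₁ (CountIs-Fin-decidable (Between? a b))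

    CountIs-Between : ∀ a b → CountIs (Between a b) (#Between a b)
    CountIs-Between a b = proj₂ (CountIs-Fin-decidable (Between? a b))

    <-irrefl′ : ∀ {a} → ¬ a <ₚ a
    <-irrefl′ (a≤a , a≰a) = a≰a a≤a

    -- Splitting an interval at an interior point z strictly shrinks both halves, as z itself leaves.
    left-smaller : ∀ {a b z} → Between a b z → #Between a z < #Between a b
    left-smaller {a} {b} {z} (a<z , z<b) =
      CountIs-mono-< (Between? a z)
        (λ (a<w , (w⊑z , z⋢w)) → a<w , (⊑.trans w⊑z (proj₁ z<b) , λ b⊑w → z⋢w (⊑.trans (proj₁ z<b) b⊑w)))
        (CountIs-Between a z) (CountIs-Between a b) (a<z , z<b) (<-irrefl′ ∘ proj₂)

    right-smaller : ∀ {a b z} → Between a b z → #Between z b < #Between a b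
    right-smaller {a} {b} {z} (a<z , z<b) =
      CountIs-mono-< (Between? z b)
        (λ ((z⊑w , w⋢z) , w<b) → (⊑.trans (proj₁ a<z) z⊑w , λ w⊑a → w⋢z (⊑.trans w⊑a (proj₁ a<z))) , w<b)
        (CountIs-Between z b) (CountIs-Between a b) (a<z , z<b) (<-irrefl′ ∘ proj₁)

    open SatChainProperties {_≤_ = _⊑_} ⊑.trans

    refine : ∀ {a b} → Acc _<_ (#Between a b) → a ⊑ b → ∃ λ s → SatChain _⊑_ a b s × (a ≢ b → 1 ≤ s)
    refine {a} {b} (acc smaller) a⊑b with a Fin.≟ b
    ... | yes refl = 0 , done ⊑.refl ⊑.refl , λ a≢a → ⊥-elim (a≢a refl)
    ... | no a≢b with Fin.any? (Between? a b)
    ...   | no nothing-between =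
      1 , step ((a⊑b , a≢b ∘ ⊑.antisym a⊑b) , λ z btw → nothing-between (z , btw)) (done ⊑.refl ⊑.refl) ,
      λ _ → s≤s z≤n
    ...   | yes (z , btw@(a<z , z<b)) with refine (smaller (left-smaller btw)) (proj₁ a<z)
                                           | refine (smaller (right-smaller btw)) (proj₁ z<b)
    ...     | s , a→z , positive | s′ , z→b , _ =
      s + s′ , SatChain-++ a→z z→b , λ _ → ≤-trans (positive λ { refl → <-irrefl′ a<z }) (m≤m+n s s′)

  SatChain-from-≤ : ∀ {a b} → a ⊑ b → ∃ λ s → SatChain _⊑_ a b s × (a ≢ b → 1 ≤ s)
  SatChain-from-≤ = refine (<-wellFounded _)

module Pointwise {A : Set} {_≲_ : A → A → Set} (isPreorder : IsPreorder _≡_ _≲_)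
                 {m : ℕ} {X : Set} (vec : X → Vec A m) where

  private
    module ≲ = IsPreorder isPreorder

  _≲ᵖ_ : X → X → Set
  x ≲ᵖ y = ∀ i → lookup (vec x) i ≲ lookup (vec y) i

  Covers-single : ∀ {x y} I → Covers _≲_ (lookup (vec x) I) (lookup (vec y) I) →
    (∀ i → i ≢ I → lookup (vec x) i ≡ lookup (vec y) i) → Covers _≲ᵖ_ x y
  Covers-single {x} {y} I ((xI≲yI , yI≴xI) , nothing-between) agree =
    (x≲y , λ y≲x → yI≴xI (y≲x I)) , no-middle
    where
    x≲y : x ≲ᵖ y
    x≲y i with i Fin.≟ I
    ... | yes refl = xI≲yI
    ... | no i≢I   = ≲.reflexive (agree i i≢I)
    no-middle : ∀ z → ¬ (Lt _≲ᵖ_ x z × Lt _≲ᵖ_ z y)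
    no-middle z ((x≲z , z≴x) , (z≲y , y≴z)) =
      nothing-between (lookup (vec z) I) ((x≲z I , z≴x ∘ below) , (z≲y I , y≴z ∘ above))
      where
      below : lookup (vec z) I ≲ lookup (vec x) I → z ≲ᵖ x
      below zI≲xI i with i Fin.≟ I
      ... | yes refl = zI≲xI
      ... | no i≢I   = ≲.trans (z≲y i) (≲.reflexive (sym (agree i i≢I)))
      above : lookup (vec y) I ≲ lookup (vec z) I → y ≲ᵖ z
      above yI≲zI i with i Fin.≟ I
      ... | yes refl = yI≲zI
      ... | no i≢I   = ≲.trans (≲.reflexive (sym (agree i i≢I))) (x≲z i)

  module _ (_≟_ : DecidableEquality A)
           (refine : ∀ {a b} → a ≲ b → ∃ λ s → SatChain _≲_ a b s × (a ≢ b → 1 ≤ s)) where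

    open SatChainProperties {_≤_ = _≲_} ≲.trans

    -- Each step of the chain moves at least one coordinate, and each coordinate's move refines to a
    -- saturated chain of positive length if it is a proper move.
    SatChain-project : ∀ {x y N} → SatChain _≲ᵖ_ x y N →
      ∃ λ (s : Fin m → ℕ) → (∀ i → SatChain _≲_ (lookup (vec x) i) (lookup (vec y) i) (s i)) × N ≤ sum s
    SatChain-project (done x≲y y≲x) = (λ _ → 0) , (λ i → done (x≲y i) (y≲x i)) , z≤n
    SatChain-project {x} (step {c = z} {L = N} ((x≲z , z≴x) , _) rest) with SatChain-project rest
    ... | s , chains , N≤s = (λ i → t i + s i) , (λ i → SatChain-++ (first i) (chains i)) , bound
      where
      t : Fin m → ℕ
      t i = proj₁ (refine (x≲z i))
      first : ∀ i → SatChain _≲_ (lookup (vec x) i) (lookup (vec z) i) (t i)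
      first i = proj₁ (proj₂ (refine (x≲z i)))
      moved : ∃ λ I → lookup (vec x) I ≢ lookup (vec z) I
      moved = Fin.¬∀⟶∃¬ m _ (λ i → lookup (vec x) i ≟ lookup (vec z) i)
        (λ unmoved → z≴x λ i → ≲.reflexive (sym (unmoved i)))
      bound : suc N ≤ sum (λ i → t i + s i)
      bound = let I , xI≢zI = moved in subst (suc N ≤_) (sym (sum-+ t s))
        (+-mono-≤ (≤-trans (proj₂ (proj₂ (refine (x≲z I))) xI≢zI) (term≤sum t I)) N≤s)

-- The m-cover poset

module CoverPosetTheory {n : ℕ} (P : FiniteBoundedPoset n) (m : ℕ) where

  open FiniteBoundedPoset P renaming (_≤_ to _⊑_)

  private
    module ⊑ = IsPartialOrder isPartialOrder

  ⊑⊥̂⇒≡⊥̂ : ∀ {x} → x ⊑ ⊥̂ → x ≡ ⊥̂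
  ⊑⊥̂⇒≡⊥̂ x⊑⊥̂ = ⊑.antisym x⊑⊥̂ (⊥̂-least _)

  ⋖⇒≢ : ∀ {p q} → p ⋖ q → p ≢ q
  ⋖⇒≢ ((_ , q⋢p) , _) refl = q⋢p ⊑.refl

  ⋖⇒≢⊥̂ : ∀ {p q} → p ⋖ q → q ≢ ⊥̂
  ⋖⇒≢⊥̂ {p} ((_ , q⋢p) , _) refl = q⋢p (⊥̂-least p)

  NonBotSetOK-single : ∀ {v : Vec (Fin n) m} {p} →
    (∀ i → lookup v i ≡ ⊥̂ ⊎ lookup v i ≡ p) → NonBotSetOK v
  NonBotSetOK-single {v} {p} values with p Fin.≟ ⊥̂ | Fin.any? (λ i → lookup v i Fin.≟ p)
  ... | yes refl | _          = inj₁ (λ i → [ id , id ] (values i))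
  ... | no p≢⊥̂   | yes occurs = inj₂ (inj₁ (p , p≢⊥̂ , values , occurs))
  ... | no _     | no absent  = inj₁ (λ i → [ id , ⊥-elim ∘ absent ∘ (i ,_) ] (values i))

  NonBotSetOK-cover : ∀ {v : Vec (Fin n) m} {p q} → p ⋖ q →
    (∀ i → lookup v i ≡ ⊥̂ ⊎ lookup v i ≡ p ⊎ lookup v i ≡ q) → NonBotSetOK v
  NonBotSetOK-cover {v} {p} {q} p⋖q values with Fin.any? (λ i → lookup v i Fin.≟ q)
  ... | no q-absent =
    NonBotSetOK-single {v} {p} (λ i → [ inj₁ , [ inj₂ , ⊥-elim ∘ q-absent ∘ (i ,_) ] ] (values i))
  ... | yes q-occurs with p Fin.≟ ⊥̂ | Fin.any? (λ i → lookup v i Fin.≟ p)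
  ...   | yes refl | _           = NonBotSetOK-single {v} {q} (λ i → [ inj₁ , [ inj₁ , inj₂ ] ] (values i))
  ...   | no _     | no p-absent =
    NonBotSetOK-single {v} {q} (λ i → [ inj₁ , [ ⊥-elim ∘ p-absent ∘ (i ,_) , inj₂ ] ] (values i))
  ...   | no p≢⊥̂   | yes p-occurs =
    inj₂ (inj₂ (p , q , p≢⊥̂ , ⋖⇒≢⊥̂ p⋖q , p⋖q , values , p-occurs , q-occurs))

  staircase-multichain : ∀ {x y z a e} → x ⊑ y → y ⊑ z → IsMultichain {m} (staircase x y z a e)
  staircase-multichain x⊑y y⊑z i j = staircase-monotone _⊑_ ⊑.refl x⊑y y⊑z (⊑.trans x⊑y y⊑z) {i = i} {j = j}

  constant : Fin n → CoverPoset m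
  constant a = replicate m a ,
    (λ i j _ → subst₂ _⊑_ (sym (lookup-replicate i a)) (sym (lookup-replicate j a)) ⊑.refl) ,
    NonBotSetOK-single {replicate m a} {a} (λ i → inj₂ (lookup-replicate i a))

  private
    _≼_ : CoverPoset m → CoverPoset m → Set
    _≼_ = CoverOrder m

    ≼-trans : ∀ {x y z : CoverPoset m} → x ≼ y → y ≼ z → x ≼ z
    ≼-trans x≼y y≼z i = ⊑.trans (x≼y i) (y≼z i)

    ≡⇒⊑ : ∀ {x y} → x ≡ y → x ⊑ y
    ≡⇒⊑ = ⊑.reflexive

  open SatChainProperties {_≤_ = _≼_} (λ {x} {y} {z} → ≼-trans {x} {y} {z})
    renaming (SatChain-respˡ to SatChain-respˡ-≼; SatChain-++ to SatChain-++-≼)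
  open Pointwise ⊑.isPreorder {X = CoverPoset m} proj₁

  module _ {a c : Fin n} (a⋖c : a ⋖ c) where

    segment : ℕ → CoverPoset m
    segment s = staircase a c c s s ,
      staircase-multichain (proj₁ (proj₁ a⋖c)) ⊑.refl ,
      NonBotSetOK-cover {staircase a c c s s} a⋖c (λ i → inj₂ (map₂ [ id , id ] (staircase-values i)))

    segment-cover : ∀ {s} → s < m → Covers _≼_ (segment (suc s)) (segment s)
    segment-cover {s} s<m = Covers-single {segment (suc s)} {segment s} I
      (subst₂ _⋖_ (sym (lookup-staircase-< I (≤-reflexive (cong suc I≡s))))
                  (sym (lookup-staircase-≥ I s≤I s≤I)) a⋖c)
      agree
      where
      I = fromℕ< s<m
      I≡s : toℕ I ≡ s
      I≡s = Fin.toℕ-fromℕ< s<m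
      s≤I = ≤-reflexive (sym I≡s)
      agree : ∀ i → i ≢ I → lookup (staircase a c c (suc s) (suc s)) i ≡ lookup (staircase a c c s s) i
      agree i i≢I with <-cmp (toℕ i) s
      ... | tri< i<s _ _ = trans (lookup-staircase-< i (m<n⇒m<1+n i<s)) (sym (lookup-staircase-< i i<s))
      ... | tri≈ _ i≡s _ = ⊥-elim (i≢I (Fin.toℕ-injective (trans i≡s (sym I≡s))))
      ... | tri> _ _ s<i = trans (lookup-staircase-≥ i s<i s<i) (sym (lookup-staircase-≥ i (<⇒≤ s<i) (<⇒≤ s<i)))

    segment-chain : ∀ s → s ≤ m → SatChain _≼_ (segment s) (constant c) s
    segment-chain zero    _      = done (λ i → ≡⇒⊑ (to-c i)) (λ i → ≡⇒⊑ (sym (to-c i)))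
      where
      to-c : ∀ i → lookup (staircase a c c 0 0) i ≡ lookup (replicate m c) i
      to-c i = trans (lookup-staircase-≥ i z≤n z≤n) (sym (lookup-replicate i c))
    segment-chain (suc s) s<m = step (segment-cover s<m) (segment-chain s (<⇒≤ s<m))

    cover-lift : SatChain _≼_ (constant a) (constant c) m
    cover-lift = SatChain-respˡ-≼ (λ i → ≡⇒⊑ (sym (from-a i))) (λ i → ≡⇒⊑ (from-a i)) (segment-chain m ≤-refl)
      where
      from-a : ∀ i → lookup (staircase a c c m m) i ≡ lookup (replicate m a) i
      from-a i = trans (lookup-staircase-< i (Fin.toℕ<n i)) (sym (lookup-replicate i a))

  SatChain-lift : ∀ {a t L} → SatChain _⊑_ a t L → SatChain _≼_ (constant a) (constant t) (m * L)
  SatChain-lift {a} {t} (done a⊑t t⊑a) = subst (SatChain _≼_ _ _) (sym (*-zeroʳ m))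
    (done (λ i → subst₂ _⊑_ (sym (lookup-replicate i a)) (sym (lookup-replicate i t)) a⊑t)
          (λ i → subst₂ _⊑_ (sym (lookup-replicate i t)) (sym (lookup-replicate i a)) t⊑a))
  SatChain-lift {L = suc L} (step a⋖c rest) =
    subst (SatChain _≼_ _ _) (sym (*-suc m L)) (SatChain-++-≼ (cover-lift a⋖c) (SatChain-lift rest))

  SatChain-bound : (∀ x y → Dec (x ⊑ y)) → ∀ {b t L} → (∀ L′ → SatChain _⊑_ b t L′ → L′ ≤ L) →
    ∀ {N} → SatChain _≼_ (constant b) (constant t) N → N ≤ m * L
  SatChain-bound _⊑?_ {b} {t} {L} maximal {N} chain
    with SatChain-project Fin._≟_ (SatChain-from-≤ isPartialOrder _⊑?_) chain
  ... | s , chains , N≤s = begin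
    N                  ≤⟨ N≤s ⟩
    sum s              ≤⟨ sum-mono-≤ (λ i → maximal (s i) (coordinate i)) ⟩
    sum {m} (λ _ → L)  ≡⟨ sum-const m L ⟩
    m * L              ∎
    where
    open ≤-Reasoning
    coordinate : ∀ i → SatChain _⊑_ b t (s i)
    coordinate i =
      subst₂ (λ u v → SatChain _⊑_ u v (s i)) (lookup-replicate i b) (lookup-replicate i t) (chains i)

  length-lift : ∀ {L} → IsLength _⊑_ L → IsLength _≼_ (m * L)
  length-lift {L} (b , t , b-least , t-greatest , chain , maximal) =
    constant b , constant t ,
    (λ y i → subst (_⊑ _) (sym (lookup-replicate i b)) (b-least _)) ,
    (λ y i → subst (_ ⊑_) (sym (lookup-replicate i t)) (t-greatest _)) ,
    SatChain-lift chain ,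
    λ L′ chain′ → decidable-stable (L′ ≤? m * L) λ L′≰ →
      ¬¬-decidable λ _⊑?_ → L′≰ (SatChain-bound _⊑?_ maximal chain′)
    where
    -- The order of P is not assumed decidable; it is so classically, and the goal L′ ≤ m * L is
    -- decidable, hence stable under double negation.
    ¬¬-decidable : ¬ ¬ (∀ x y → Dec (x ⊑ y))
    ¬¬-decidable = ∀¬¬⇒¬¬∀ λ x → ∀¬¬⇒¬¬∀ λ y → ¬¬-excluded-middle

  bottom : Vec (Fin n) m
  bottom = replicate m ⊥̂

  IsOneParam : Fin n × ℕ → Set
  IsOneParam (p , a) = p ≢ ⊥̂ × a < m

  oneStair : Fin n × ℕ → Vec (Fin n) m
  oneStair (p , a) = staircase ⊥̂ p p a a

  IsUpperCover : Fin n × Fin n → Set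
  IsUpperCover pq = IsCoverPair pq × ¬ proj₁ pq ≡ ⊥̂

  IsTwoParam : (Fin n × Fin n) × (ℕ × ℕ) → Set
  IsTwoParam (pq , (a , e)) = IsUpperCover pq × (a < e × e < m)

  twoStair : (Fin n × Fin n) × (ℕ × ℕ) → Vec (Fin n) m
  twoStair ((p , q) , (a , e)) = staircase ⊥̂ p q a e

  oneStair-injective : ∀ {x y} → IsOneParam x → IsOneParam y → oneStair x ≡ oneStair y → x ≡ y
  oneStair-injective {p , a} {p′ , a′} (p≢⊥̂ , a<m) (p′≢⊥̂ , a′<m) eq
    with refl ← staircase-x-threshold p≢⊥̂ p≢⊥̂ p′≢⊥̂ p′≢⊥̂ (<⇒≤ a<m) (<⇒≤ a′<m) eq
    = cong (_, a) (trans (sym (lookup-staircase-≥-at a<m ≤-refl ≤-refl))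
                    (trans (lookup-≡ eq _) (lookup-staircase-≥-at a<m ≤-refl ≤-refl)))

  twoStair-injective : ∀ {x y} → IsTwoParam x → IsTwoParam y → twoStair x ≡ twoStair y → x ≡ y
  twoStair-injective {(p , q) , (a , e)} {(p′ , q′) , (a′ , e′)}
                     ((p⋖q , p≢⊥̂) , a<e , e<m) ((p′⋖q′ , p′≢⊥̂) , a′<e′ , e′<m) eq
    -- a is where the ⊥̂ entries end, p the entry at a, e where the entries in {⊥̂, p} end, q the entry at e.
    with refl ← staircase-x-threshold p≢⊥̂ (⋖⇒≢⊥̂ p⋖q) p′≢⊥̂ (⋖⇒≢⊥̂ p′⋖q′)
                  (<⇒≤ (<-trans a<e e<m)) (<⇒≤ (<-trans a′<e′ e′<m)) eq
    with refl ← trans (sym (lookup-staircase-mid-at (<-trans a<e e<m) ≤-refl a<e))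
                  (trans (lookup-≡ eq _) (lookup-staircase-mid-at (<-trans a<e e<m) ≤-refl a′<e′))
    with refl ← staircase-xy-threshold (⋖⇒≢⊥̂ p⋖q) (≢-sym (⋖⇒≢ p⋖q)) (⋖⇒≢⊥̂ p′⋖q′) (≢-sym (⋖⇒≢ p′⋖q′))
                  (<⇒≤ a<e) (<⇒≤ a′<e′) (<⇒≤ e<m) (<⇒≤ e′<m) eq
    with refl ← trans (sym (lookup-staircase-≥-at e<m (<⇒≤ a<e) ≤-refl))
                  (trans (lookup-≡ eq _) (lookup-staircase-≥-at e<m (<⇒≤ a′<e′) ≤-refl))
    = refl

  OneStairs TwoStairs : Vec (Fin n) m → Set
  OneStairs v = ∃ λ x → IsOneParam x × oneStair x ≡ v
  TwoStairs v = ∃ λ x → IsTwoParam x × twoStair x ≡ v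

  bottom∉OneStairs : ¬ OneStairs bottom
  bottom∉OneStairs ((p , a) , (p≢⊥̂ , a<m) , eq) = p≢⊥̂ (begin
    p                            ≡⟨ lookup-staircase-≥-at a<m ≤-refl ≤-refl ⟨
    lookup (oneStair (p , a)) I  ≡⟨ lookup-≡ eq I ⟩
    lookup bottom I              ≡⟨ lookup-replicate I ⊥̂ ⟩
    ⊥̂                            ∎)
    where
    open ≡-Reasoning
    I = fromℕ< a<m

  bottom∉TwoStairs : ¬ TwoStairs bottom
  bottom∉TwoStairs (((p , q) , (a , e)) , ((_ , p≢⊥̂) , a<e , e<m) , eq) = p≢⊥̂ (begin
    p                                    ≡⟨ lookup-staircase-mid-at a<m ≤-refl a<e ⟨
    lookup (twoStair ((p , q) , a , e)) I  ≡⟨ lookup-≡ eq I ⟩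
    lookup bottom I                      ≡⟨ lookup-replicate I ⊥̂ ⟩
    ⊥̂                                    ∎)
    where
    open ≡-Reasoning
    a<m = <-trans a<e e<m
    I = fromℕ< a<m

  OneStairs⇒¬TwoStairs : ∀ {v} → OneStairs v → ¬ TwoStairs v
  OneStairs⇒¬TwoStairs ((p , a) , (p≢⊥̂ , a<m) , refl)
                       (((p′ , q′) , (a′ , e′)) , ((p′⋖q′ , p′≢⊥̂) , a′<e′ , e′<m) , eq)
    with refl ← staircase-x-threshold p≢⊥̂ p≢⊥̂ p′≢⊥̂ (⋖⇒≢⊥̂ p′⋖q′)
                  (<⇒≤ a<m) (<⇒≤ (<-trans a′<e′ e′<m)) (sym eq)
    = ⋖⇒≢ p′⋖q′ (begin
      p′                                       ≡⟨ lookup-staircase-mid-at a<m ≤-refl a′<e′ ⟨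
      lookup (twoStair _) (fromℕ< a<m)         ≡⟨ lookup-≡ eq _ ⟩
      lookup (oneStair (p , a)) (fromℕ< a<m)   ≡⟨ lookup-staircase-≥-at a<m ≤-refl ≤-refl ⟩
      p                                        ≡⟨ lookup-staircase-≥-at e′<m (<⇒≤ a′<e′) (<⇒≤ a′<e′) ⟨
      lookup (oneStair (p , a)) (fromℕ< e′<m)  ≡⟨ lookup-≡ eq _ ⟨
      lookup (twoStair _) (fromℕ< e′<m)        ≡⟨ lookup-staircase-≥-at e′<m (<⇒≤ a′<e′) ≤-refl ⟩
      q′                                       ∎)
    where open ≡-Reasoning

  Classified : Vec (Fin n) m → Set
  Classified v = v ≡ bottom ⊎ OneStairs v ⊎ TwoStairs v

  classified⇒elt : ∀ {v} → Classified v → IsCoverPosetElt v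
  classified⇒elt (inj₁ refl) = proj₂ (constant ⊥̂)
  classified⇒elt (inj₂ (inj₁ ((p , a) , _ , refl))) =
    staircase-multichain (⊥̂-least p) ⊑.refl ,
    NonBotSetOK-single {oneStair (p , a)} {p} (λ i → map₂ [ id , id ] (staircase-values i))
  classified⇒elt (inj₂ (inj₂ (((p , q) , a , e) , ((p⋖q , _) , _) , refl))) =
    staircase-multichain (⊥̂-least p) (proj₁ (proj₁ p⋖q)) ,
    NonBotSetOK-cover {twoStair ((p , q) , a , e)} p⋖q staircase-values

  nonBottom-upward : ∀ {v : Vec (Fin n) m} → IsMultichain v → UpwardClosed (λ i → lookup v i ≢ ⊥̂)
  nonBottom-upward chain i≤j vi≢⊥̂ vj≡⊥̂ = vi≢⊥̂ (⊑⊥̂⇒≡⊥̂ (subst (_ ⊑_) vj≡⊥̂ (chain _ _ i≤j)))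

  single⇒oneStair : ∀ {v : Vec (Fin n) m} {p} → IsMultichain v → p ≢ ⊥̂ →
    (∀ i → lookup v i ≡ ⊥̂ ⊎ lookup v i ≡ p) → (∃ λ j → lookup v j ≡ p) →
    OneStairs v
  single⇒oneStair {v} {p} chain p≢⊥̂ values (j , vj≡p)
    with upwardClosed⇒threshold (λ i → ¬? (lookup v i Fin.≟ ⊥̂)) (nonBottom-upward {v} chain)
  ... | a , _ , below , above =
    (p , a) , (p≢⊥̂ , ≤-<-trans a≤j (Fin.toℕ<n j)) ,
    sym (staircase-ext (λ i i<a → decidable-stable (lookup v i Fin.≟ ⊥̂) (below i i<a))
                       (λ i a≤i i<a → ⊥-elim (≤⇒≯ a≤i i<a))
                       (λ i a≤i _ → [ ⊥-elim ∘ above i a≤i , id ] (values i)))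
    where
    a≤j : a ≤ toℕ j
    a≤j = ≮⇒≥ λ j<a → below j j<a (p≢⊥̂ ∘ trans (sym vj≡p))

  pair⇒twoStair : ∀ {v : Vec (Fin n) m} {p q} → IsMultichain v → p ⋖ q → p ≢ ⊥̂ →
    (∀ i → lookup v i ≡ ⊥̂ ⊎ lookup v i ≡ p ⊎ lookup v i ≡ q) →
    (∃ λ j → lookup v j ≡ p) → (∃ λ j → lookup v j ≡ q) →
    TwoStairs v
  pair⇒twoStair {v} {p} {q} chain p⋖q p≢⊥̂ values (j , vj≡p) (j′ , vj′≡q)
    with upwardClosed⇒threshold (λ i → ¬? (lookup v i Fin.≟ ⊥̂)) (nonBottom-upward {v} chain)
       | upwardClosed⇒threshold (λ i → lookup v i Fin.≟ q) q-upward
    where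
    q-upward : UpwardClosed (λ i → lookup v i ≡ q)
    q-upward {i} {k} i≤k vi≡q with values k
    ... | inj₁ vk≡⊥̂        = ⊥-elim (⋖⇒≢⊥̂ p⋖q (⊑⊥̂⇒≡⊥̂ (subst₂ _⊑_ vi≡q vk≡⊥̂ (chain i k i≤k))))
    ... | inj₂ (inj₁ vk≡p) = ⊥-elim (proj₂ (proj₁ p⋖q) (subst₂ _⊑_ vi≡q vk≡p (chain i k i≤k)))
    ... | inj₂ (inj₂ vk≡q) = vk≡q
  ... | a , _ , below-a , above-a | e , _ , below-e , above-e =
    ((p , q) , (a , e)) , ((p⋖q , p≢⊥̂) , ≤-<-trans a≤j j<e , ≤-<-trans e≤j′ (Fin.toℕ<n j′)) ,
    sym (staircase-ext (λ i i<a → decidable-stable (lookup v i Fin.≟ ⊥̂) (below-a i i<a))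
                       middle (λ i _ → above-e i))
    where
    a≤j : a ≤ toℕ j
    a≤j = ≮⇒≥ λ j<a → below-a j j<a (p≢⊥̂ ∘ trans (sym vj≡p))
    j<e : toℕ j < e
    j<e = ≰⇒> λ e≤j → ⋖⇒≢ p⋖q (trans (sym vj≡p) (above-e j e≤j))
    e≤j′ : e ≤ toℕ j′
    e≤j′ = ≮⇒≥ λ j′<e → below-e j′ j′<e vj′≡q
    middle : ∀ i → a ≤ toℕ i → toℕ i < e → lookup v i ≡ p
    middle i a≤i i<e with values i
    ... | inj₁ vi≡⊥̂        = ⊥-elim (above-a i a≤i vi≡⊥̂)
    ... | inj₂ (inj₁ vi≡p) = vi≡p
    ... | inj₂ (inj₂ vi≡q) = ⊥-elim (below-e i i<e vi≡q)

  elt⇒classified : ∀ {v} → IsCoverPosetElt v → Classified v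
  elt⇒classified (_ , inj₁ all-⊥̂) =
    inj₁ (Pointwise-≡⇒≡ (ext λ i → trans (all-⊥̂ i) (sym (lookup-replicate i ⊥̂))))
  elt⇒classified (chain , inj₂ (inj₁ (p , p≢⊥̂ , values , occurs))) =
    inj₂ (inj₁ (single⇒oneStair chain p≢⊥̂ values occurs))
  elt⇒classified (chain , inj₂ (inj₂ (p , q , p≢⊥̂ , _ , p⋖q , values , p-occurs , q-occurs))) =
    inj₂ (inj₂ (pair⇒twoStair chain p⋖q p≢⊥̂ values p-occurs q-occurs))

  nonBottoms : CountIs (_≢ ⊥̂) (n ∸ 1)
  nonBottoms = CountIs-cong proj₂ (tt ,_)
    (CountIs-∖ (Fin._≟ ⊥̂) (CountIs-Fin n) (CountIs-cong (tt ,_) proj₂ (CountIs-≡ ⊥̂)))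

  upperCovers : ∀ {c k} → CountIs IsCoverPair c → CountIs IsAtom k → CountIs IsUpperCover (c ∸ k)
  upperCovers covers atoms = CountIs-∖ (λ pq → proj₁ pq Fin.≟ ⊥̂) covers
    (CountIs-cong (λ { (_ , atom , refl) → atom , refl }) (λ { (atom , refl) → _ , atom , refl })
      (CountIs-image (⊥̂ ,_) (λ _ _ → cong proj₂) atoms))

  count : ∀ {c k} → CountIs IsCoverPair c → CountIs IsAtom k →
    CountIs (IsCoverPosetElt {m}) (1 + ((n ∸ 1) * m + (c ∸ k) * (m C 2)))
  count covers atoms = CountIs-cong classified⇒elt elt⇒classified
    (CountIs-⊎ (λ { refl → [ bottom∉OneStairs , bottom∉TwoStairs ] }) (CountIs-≡ bottom)
      (CountIs-⊎ OneStairs⇒¬TwoStairs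
        (CountIs-image oneStair oneStair-injective (CountIs-× nonBottoms (CountIs-< m)))
        (CountIs-image twoStair twoStair-injective (CountIs-× (upperCovers covers atoms) (CountIs-pairs< m)))))

proposition2p1 : ∀ {n : ℕ} (P : FiniteBoundedPoset n) (m : ℕ) → 1 ≤ m →
    ∀ (c k : ℕ) →
    CountIs (FiniteBoundedPoset.IsCoverPair P) c →
    CountIs (FiniteBoundedPoset.IsAtom P) k →
    (∀ (L : ℕ) → IsLength (FiniteBoundedPoset._≤_ P) L →
       IsLength (FiniteBoundedPoset.CoverOrder P m) (m * L))
    × CountIs (FiniteBoundedPoset.IsCoverPosetElt P {m})
        ((c ∸ k) * (m C 2) + m * (n ∸ 1) + 1)
proposition2p1 {n} P m _ c k covers atoms =
  (λ _ → length-lift) ,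
  subst (CountIs _) (rearrange (n ∸ 1) m (c ∸ k) (m C 2)) (count covers atoms)
  where
  open CoverPosetTheory P m
  rearrange : ∀ x y z w → 1 + (x * y + z * w) ≡ z * w + y * x + 1
  rearrange = solve-∀
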